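{- Let $\varepsilon$ be a system of equations as described, let $\varepsilon_i$ be an entry of $\varepsilon$ of the form $u_i+v_i=w_i$, and let $\mathcal{M}$ be a well-prepared finite structure. Then $\mathcal{M}\models\exists^{=50\%}x\,\big(A_{w_i}(x)\vee(F_i(x)\wedge\neg A_{u_i}(x)\wedge\neg A_{v_i}(x))\big)$ if and only if $|A_{u_i}^{\mathcal{M}}|+|A_{v_i}^{\mathcal{M}}|=|A_{w_i}^{\mathcal{M}}|$.
   Context: A system $\varepsilon$ consists of entries $\varepsilon_1,\dots,\varepsilon_m$, each of one of the forms $u=1$, $u=v+w$ or $u=v\cdot w$ (written here as $u_i+v_i=w_i$ resp. $u_i\cdot v_i=w_i$ for three-variable entries), where the variables in each entry are pairwise distinct; $\mathrm{Var}(\varepsilon)$ is the set of variables occurring. The signature contains a unary predicate $A_u$ for each $u\in\mathrm{Var}(\varepsilon)$ and unary predicates $F_i,S_i$ for each $i$. A finite structure $\mathcal{M}$ (with domain $M$) is well-prepared if: (1) no element satisfies $A_u$ and $A_v$ for distinct $u,v\in\mathrm{Var}(\varepsilon)$; (2) for each entry $\varepsilon_i$ of form $u_i=1$, exactly one element satisfies $A_{u_i}$; (3) for each entry $\varepsilon_i$ of form $u_i+v_i=w_i$ or $u_i\cdot v_i=w_i$: every element satisfies exactly one of $F_i,S_i$, exactly half of the elements of $M$ satisfy $F_i$, every element satisfying $A_{u_i}$ or $A_{v_i}$ satisfies $F_i$, and every element satisfying $A_{w_i}$ satisfies $S_i$. The quantifier $\exists^{=50\%}x\,\psi(x)$ holds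 in $\mathcal{M}$ iff exactly $\frac12|M|$ elements satisfy $\psi$. -}

module Defs where

open import Data.Nat using (ℕ; zero; suc; _+_; _*_)
open import Data.Bool using (Bool; true; false; not; _∧_; _∨_)
open import Data.Fin using (Fin; zero; suc)
open import Data.Vec using (Vec; lookup)
open import Data.Product using (Σ; ∃; _×_; _,_)
open import Data.Sum using (_⊎_)
open import Relation.Binary.PropositionalEquality using (_≡_; _≢_)
open import Relation.Nullary using (¬_)
open import Data.Unit using (⊤)

Variable : Set
Variable = ℕ

-- Entries of a system: u = 1, u + v = w, u · v = w.
data Entry : Set where
  one : Variable → Entry
  add : Variable → Variable → Variable → Entry
  mul : Variable → Variable → Variable → Entry

DistinctVars : Entry → Set
DistinctVars (one u) = ⊤
DistinctVars (add u v w) = u ≢ v × u ≢ w × v ≢ w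
DistinctVars (mul u v w) = u ≢ v × u ≢ w × v ≢ w

System : ℕ → Set
System m = Vec Entry m

WellFormedSystem : ∀ {m} → System m → Set
WellFormedSystem {m} ε = (i : Fin m) → DistinctVars (lookup ε i)

OccursIn : Variable → Entry → Set
OccursIn x (one u) = x ≡ u
OccursIn x (add u v w) = x ≡ u ⊎ x ≡ v ⊎ x ≡ w
OccursIn x (mul u v w) = x ≡ u ⊎ x ≡ v ⊎ x ≡ w

_∈Var_ : ∀ {m} → Variable → System m → Set
_∈Var_ {m} x ε = Σ (Fin m) λ i → OccursIn x (lookup ε i)

ThreeVar : Entry → Variable → Variable → Variable → Set
ThreeVar e u v w = e ≡ add u v w ⊎ e ≡ mul u v w

record Structure (m n : ℕ) : Set where
  field
    A : Variable → Fin n → Bool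
    F : Fin m → Fin n → Bool
    S : Fin m → Fin n → Bool

count : ∀ {n} → (Fin n → Bool) → ℕ
count {zero} p = 0
count {suc n} p with p zero
... | true  = suc (count {n} (λ x → p (suc x)))
... | false = count {n} (λ x → p (suc x))

Exists50 : ∀ {n} → (Fin n → Bool) → Set
Exists50 {n} ψ = 2 * count ψ ≡ n

record WellPrepared {m n : ℕ} (ε : System m) (M : Structure m n) : Set where
  open Structure M
  field
    disjoint : ∀ u v → u ∈Var ε → v ∈Var ε → u ≢ v →
               ∀ x → ¬ (A u x ≡ true × A v x ≡ true)
    unit : ∀ (i : Fin m) u → lookup ε i ≡ one u → count (A u) ≡ 1
    exactlyOne : ∀ (i : Fin m) u v w → ThreeVar (lookup ε i) u v w →
                 ∀ x → (F i x ≡ true × S i x ≡ false) ⊎ (F i x ≡ false × S i x ≡ true)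
    half : ∀ (i : Fin m) u v w → ThreeVar (lookup ε i) u v w →
           2 * count (F i) ≡ n
    firstF : ∀ (i : Fin m) u v w → ThreeVar (lookup ε i) u v w →
             ∀ x → A u x ≡ true ⊎ A v x ≡ true → F i x ≡ true
    thirdS : ∀ (i : Fin m) u v w → ThreeVar (lookup ε i) u v w →
             ∀ x → A w x ≡ true → S i x ≡ true

{-# OPTIONS --safe #-}
module Submission where

-- Pointwise, the indicators satisfy [ψ] + [A_u] + [A_v] = [A_w] + [F_i]: an element of A_u or A_v
-- lies in F_i and is counted once on each side, an element of A_w lies outside F_i, and every
-- other element is in ψ exactly when it is in F_i. Summing over M gives
-- |ψ| + |A_u| + |A_v| = |A_w| + |F_i|, and since |F_i| = |M|/2, ψ holds of exactly half of M
-- iff |ψ| = |F_i| iff |A_u| + |A_v| = |A_w|.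

open import Defs
open import Data.Nat using (ℕ; zero; suc; _+_; _*_)
open import Data.Nat.Properties
  using (+-assoc; +-comm; +-cancelˡ-≡; +-cancelʳ-≡; *-cancelˡ-≡; +-0-commutativeMonoid)
open import Data.Bool using (Bool; true; false; not; _∧_; _∨_)
open import Data.Fin using (Fin; zero; suc)
open import Data.Vec using (lookup)
open import Data.Product using (_×_; _,_; proj₁)
open import Data.Sum using (inj₁; inj₂)
open import Data.Empty using (⊥-elim)
open import Relation.Nullary using (¬_)
open import Relation.Binary.PropositionalEquality
  using (_≡_; _≢_; refl; sym; trans; cong; cong₂; subst; module ≡-Reasoning)
open import Function.Bundles using (_⇔_; mk⇔)
open import Algebra.Properties.CommutativeMonoid.Sum +-0-commutativeMonoid
  using (sum; ∑-distrib-+; sum-cong-≋)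

𝟙 : Bool → ℕ
𝟙 true  = 1
𝟙 false = 0

count≡sum : ∀ {n} (p : Fin n → Bool) → count p ≡ sum (λ x → 𝟙 (p x))
count≡sum {zero}  p = refl
count≡sum {suc n} p with p zero
... | true  = cong suc (count≡sum (λ x → p (suc x)))
... | false = count≡sum (λ x → p (suc x))

count-+ : ∀ {n} (p q : Fin n → Bool) → count p + count q ≡ sum (λ x → 𝟙 (p x) + 𝟙 (q x))
count-+ p q = begin
  count p + count q
    ≡⟨ cong₂ _+_ (count≡sum p) (count≡sum q) ⟩
  sum (λ x → 𝟙 (p x)) + sum (λ x → 𝟙 (q x))
    ≡⟨ sym (∑-distrib-+ (λ x → 𝟙 (p x)) (λ x → 𝟙 (q x))) ⟩
  sum (λ x → 𝟙 (p x) + 𝟙 (q x)) ∎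
  where open ≡-Reasoning

count-+-+ : ∀ {n} (p q r : Fin n → Bool) →
            count p + count q + count r ≡ sum (λ x → 𝟙 (p x) + 𝟙 (q x) + 𝟙 (r x))
count-+-+ p q r = begin
  count p + count q + count r
    ≡⟨ cong (_+ count r) (count-+ p q) ⟩
  sum (λ x → 𝟙 (p x) + 𝟙 (q x)) + count r
    ≡⟨ cong (_ +_) (count≡sum r) ⟩
  sum (λ x → 𝟙 (p x) + 𝟙 (q x)) + sum (λ x → 𝟙 (r x))
    ≡⟨ sym (∑-distrib-+ (λ x → 𝟙 (p x) + 𝟙 (q x)) (λ x → 𝟙 (r x))) ⟩
  sum (λ x → 𝟙 (p x) + 𝟙 (q x) + 𝟙 (r x)) ∎
  where open ≡-Reasoning

indicator-balance : ∀ (au av aw f : Bool) → ¬ (au ≡ true × av ≡ true) →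
                    (au ≡ true → f ≡ true) → (av ≡ true → f ≡ true) → (aw ≡ true → f ≡ false) →
                    𝟙 (aw ∨ (f ∧ not au ∧ not av)) + 𝟙 au + 𝟙 av ≡ 𝟙 aw + 𝟙 f
indicator-balance true  true  aw    f     u∩v=∅ _   _   _ = ⊥-elim (u∩v=∅ (refl , refl))
indicator-balance true  false aw    f     _     u⇒f _   w⇒¬f with u⇒f refl
indicator-balance true  false false .true _     _   _   _    | refl = refl
indicator-balance true  false true  .true _     _   _   w⇒¬f | refl with w⇒¬f refl
... | ()
indicator-balance false true  aw    f     _     _   v⇒f w⇒¬f with v⇒f refl
indicator-balance false true  false .true _     _   _   _    | refl = refl
indicator-balance false true  true  .true _     _   _   w⇒¬f | refl with w⇒¬f refl
... | ()
indicator-balance false false true  f     _     _   _   w⇒¬f with w⇒¬f refl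
... | refl = refl
indicator-balance false false false true  _     _   _   _ = refl
indicator-balance false false false false _     _   _   _ = refl

half-iff-balanced : ∀ {n c a b d f : ℕ} → c + a + b ≡ d + f → 2 * f ≡ n →
                    (2 * c ≡ n) ⇔ (a + b ≡ d)
half-iff-balanced {n} {c} {a} {b} {d} {f} balance 2f≡n = mk⇔ to from
  where
  balance′ : c + (a + b) ≡ f + d
  balance′ = trans (sym (+-assoc c a b)) (trans balance (+-comm d f))

  to : 2 * c ≡ n → a + b ≡ d
  to 2c≡n with *-cancelˡ-≡ c f 2 (trans 2c≡n (sym 2f≡n))
  ... | refl = +-cancelˡ-≡ c _ _ balance′

  from : a + b ≡ d → 2 * c ≡ n
  from refl = trans (cong (2 *_) (+-cancelʳ-≡ (a + b) c f balance′)) 2f≡n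

additionFormula : ∀ {m n} → Structure m n → Fin m → Variable → Variable → Variable → Fin n → Bool
additionFormula M i u v w x =
  A w x ∨ (F i x ∧ not (A u x) ∧ not (A v x))
  where open Structure M

module _ {m n : ℕ} {ε : System m} {M : Structure m n} (wp : WellPrepared ε M)
         {i : Fin m} {u v w : Variable} (εᵢ≡u+v=w : lookup ε i ≡ add u v w) where

  open Structure M
  open WellPrepared wp

  private
    three : ThreeVar (lookup ε i) u v w
    three = inj₁ εᵢ≡u+v=w

    occurs : ∀ {x} → OccursIn x (add u v w) → x ∈Var ε
    occurs o = i , subst (OccursIn _) (sym εᵢ≡u+v=w) o

    Aw⇒¬F : ∀ x → A w x ≡ true → F i x ≡ false
    Aw⇒¬F x Awx with exactlyOne i u v w three x
    ... | inj₂ (¬Fx , _) = ¬Fx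
    ... | inj₁ (_ , ¬Sx) with trans (sym ¬Sx) (thirdS i u v w three x Awx)
    ...   | ()

  additionFormula-balance : WellFormedSystem ε →
    count (additionFormula M i u v w) + count (A u) + count (A v) ≡ count (A w) + count (F i)
  additionFormula-balance wf = begin
    count (additionFormula M i u v w) + count (A u) + count (A v)
      ≡⟨ count-+-+ (additionFormula M i u v w) (A u) (A v) ⟩
    sum (λ x → 𝟙 (additionFormula M i u v w x) + 𝟙 (A u x) + 𝟙 (A v x))
      ≡⟨ sum-cong-≋ pointwise ⟩
    sum (λ x → 𝟙 (A w x) + 𝟙 (F i x))
      ≡⟨ sym (count-+ (A w) (F i)) ⟩
    count (A w) + count (F i) ∎
    where
    open ≡-Reasoning
    u≢v : u ≢ v
    u≢v = proj₁ (subst DistinctVars εᵢ≡u+v=w (wf i))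
    pointwise : ∀ x → 𝟙 (additionFormula M i u v w x) + 𝟙 (A u x) + 𝟙 (A v x)
                      ≡ 𝟙 (A w x) + 𝟙 (F i x)
    pointwise x = indicator-balance (A u x) (A v x) (A w x) (F i x)
      (disjoint u v (occurs (inj₁ refl)) (occurs (inj₂ (inj₁ refl))) u≢v x)
      (λ Aux → firstF i u v w three x (inj₁ Aux))
      (λ Avx → firstF i u v w three x (inj₂ Avx))
      (Aw⇒¬F x)

lemma7 : ∀ {m n : ℕ} (ε : System m) → WellFormedSystem ε →
         (i : Fin m) (u v w : Variable) → lookup ε i ≡ add u v w →
         (M : Structure m n) → WellPrepared ε M →
         Exists50 (λ x → Structure.A M w x ∨
                   (Structure.F M i x ∧ not (Structure.A M u x) ∧ not (Structure.A M v x)))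
         ⇔ (count (Structure.A M u) + count (Structure.A M v) ≡ count (Structure.A M w))
lemma7 ε wf i u v w εᵢ≡u+v=w M wp =
  half-iff-balanced {c = count (additionFormula M i u v w)} {a = count (A u)} {b = count (A v)}
    (additionFormula-balance wp εᵢ≡u+v=w wf)
    (WellPrepared.half wp i u v w (inj₁ εᵢ≡u+v=w))
  where open Structure M
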